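{- $128 \leq R(4,4,4)$.
   Context: $R(4,4,4)$ is the three-color Ramsey number: the smallest integer $l$ such that every coloring of the edges of the complete graph $K_l$ with three colors contains a complete subgraph $K_4$ all of whose edges have the same color. -}

module Defs where

open import Data.Nat using (ℕ; _≤_)
open import Data.Fin using (Fin; _<_)
open import Data.Product using (Σ; ∃; _×_)
open import Relation.Binary.PropositionalEquality using (_≡_)

-- An edge 3-colouring of the complete graph K_l on vertex set Fin l:
-- each unordered pair {i, j} (i ≠ j) is represented by the ordered pair
-- with i < j, and gets a colour in Fin 3.
EdgeColouring : ℕ → Set
EdgeColouring l = (i j : Fin l) → i < j → Fin 3

HasMonoK4 : {l : ℕ} → EdgeColouring l → Set
HasMonoK4 {l} χ =
  Σ (Fin 3) λ k →
  Σ (Fin l) λ a → Σ (Fin l) λ b → Σ (Fin l) λ c → Σ (Fin l) λ d →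
  Σ (a < b) λ ab → Σ (b < c) λ bc → Σ (c < d) λ cd →
  Σ (a < c) λ ac → Σ (a < d) λ ad → Σ (b < d) λ bd →
    (χ a b ab ≡ k) × (χ a c ac ≡ k) × (χ a d ad ≡ k) ×
    (χ b c bc ≡ k) × (χ b d bd ≡ k) × (χ c d cd ≡ k)

Arrows444 : ℕ → Set
Arrows444 l = (χ : EdgeColouring l) → HasMonoK4 χ

-- "n ≤ R(4,4,4)", where R(4,4,4) is the smallest l with Arrows444 l:
-- every l with the arrowing property is at least n.
LowerBoundR444 : ℕ → Set
LowerBoundR444 n = (l : ℕ) → Arrows444 l → n ≤ l

-- R(4,4,4) ≥ 128: an explicit 3-colouring of K_127 with no monochromatic K_4.
--
-- The colouring is a distance (Cayley) colouring: the edge {i, j} with i < j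
-- gets colour f (j − i), where f n records which coset of the subgroup of
-- cubes in (ℤ/127)ˣ contains n, read off from the cube root of unity n^42
-- mod 127 (127 is prime and 126 = 3 · 42).

module Submission where

open import Defs
open import Data.Bool using (Bool; true; T; not; _∧_; _∨_)
open import Data.Bool.Properties using (T-∧)
open import Data.Empty using (⊥-elim)
open import Data.Unit using (tt)
open import Data.Fin using (Fin; zero; suc; toℕ)
open import Data.Fin.Properties using (toℕ<n) renaming (_≟_ to _≟ᶠ_)
open import Data.List using ([]; _∷_; List)
open import Data.List.Relation.Unary.All using (All; []; _∷_; all?)
open import Data.Nat using (ℕ; zero; suc; _+_; _∸_; _^_; _%_; _≤_; _<_; _<ᵇ_; s≤s; z≤n)
open import Data.Nat.Properties
  using (_≤?_; ≰⇒>; ≤-pred; ≤-trans; <⇒≤; ≤-<-trans; m∸n≤m; m<n⇒0<n∸m; ∸-monoˡ-<;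
         ∸-+-assoc; m+[n∸m]≡n; m<1+n⇒m<n∨m≡n)
open import Data.Product using (_,_)
open import Data.Sum using (inj₁; inj₂)
open import Function.Bundles using (Equivalence)
open import Relation.Nullary using (¬_; isYes; yes; no)
open import Relation.Nullary.Decidable using (Dec; toWitnessFalse)
open import Relation.Binary.PropositionalEquality using (_≡_; refl; sym; trans; cong)
open Relation.Binary.PropositionalEquality.≡-Reasoning

distanceColouring : (ℕ → Fin 3) → (l : ℕ) → EdgeColouring l
distanceColouring f l i j _ = f (toℕ j ∸ toℕ i)

-- The gaps of the vertex set {0 < p < q < r} other than r itself; those of
-- the triangle {0, q, r} come first, so the search below prunes on them.
otherGaps : ℕ → ℕ → ℕ → List ℕ
otherGaps p q r = q ∷ r ∸ q ∷ p ∷ q ∸ p ∷ r ∸ p ∷ []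

MonoGaps : (ℕ → Fin 3) → ℕ → ℕ → ℕ → Set
MonoGaps f p q r = All (λ x → f x ≡ f r) (otherGaps p q r)

monoGaps? : (f : ℕ → Fin 3) (p q r : ℕ) → Dec (MonoGaps f p q r)
monoGaps? f p q r = all? (λ x → f x ≟ᶠ f r) (otherGaps p q r)

DistanceK4Free : (ℕ → Fin 3) → ℕ → Set
DistanceK4Free f n =
  ∀ {p q r} → 0 < p → p < q → q < r → r < n → ¬ MonoGaps f p q r

gap-translation : ∀ {a x} y → a ≤ x → (y ∸ a) ∸ (x ∸ a) ≡ y ∸ x
gap-translation {a} {x} y a≤x = begin
  (y ∸ a) ∸ (x ∸ a)   ≡⟨ ∸-+-assoc y a (x ∸ a) ⟩
  y ∸ (a + (x ∸ a))   ≡⟨ cong (y ∸_) (m+[n∸m]≡n a≤x) ⟩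
  y ∸ x               ∎

-- Translation: a monochromatic K_4 {a < b < c < d} of the distance colouring
-- yields the difference K_4 {0, b − a, c − a, d − a}, whose gaps are the
-- original edge gaps; so distance-K_4-freeness below n rules it out on K_l.
distanceColouring-noMonoK4 :
  ∀ {f n l} → DistanceK4Free f n → l ≤ n → ¬ HasMonoK4 (distanceColouring f l)
distanceColouring-noMonoK4 {f} free l≤n
  (k , a , b , c , d , ab , bc , cd , ac , _ , _ , χab , χac , χad , χbc , χbd , χcd) =
  free (m<n⇒0<n∸m ab) (∸-monoˡ-< bc (<⇒≤ ab)) (∸-monoˡ-< cd (<⇒≤ ac))
       (≤-<-trans (m∸n≤m D A) (≤-trans (toℕ<n d) l≤n))
       (sameAsR χac ∷ sameAsR (shift C (<⇒≤ ac) χcd) ∷ sameAsR χab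
         ∷ sameAsR (shift B (<⇒≤ ab) χbc) ∷ sameAsR (shift B (<⇒≤ ab) χbd) ∷ [])
  where
  A B C D : ℕ
  A = toℕ a
  B = toℕ b
  C = toℕ c
  D = toℕ d
  shift : ∀ x {y} → A ≤ x → f (y ∸ x) ≡ k → f ((y ∸ A) ∸ (x ∸ A)) ≡ k
  shift x {y} A≤x e = trans (cong f (gap-translation y A≤x)) e
  sameAsR : ∀ {x} → f x ≡ k → f x ≡ f (D ∸ A)
  sameAsR e = trans e (sym χad)

allBelow : ℕ → (ℕ → Bool) → Bool
allBelow zero    b = true
allBelow (suc n) b = b n ∧ allBelow n b

allBelow-sound : ∀ {n b m} → T (allBelow n b) → m < n → T (b m)
allBelow-sound {suc n} holds m<1+n with Equivalence.to T-∧ holds | m<1+n⇒m<n∨m≡n m<1+n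
... | _ , rest | inj₁ m<n  = allBelow-sound rest m<n
... | bn , _   | inj₂ refl = bn

distanceK4Freeᵇ : (ℕ → Fin 3) → ℕ → Bool
distanceK4Freeᵇ f n =
  allBelow n λ r → allBelow r λ q → allBelow q λ p →
    not (0 <ᵇ p) ∨ not (isYes (monoGaps? f p q r))

distanceK4Freeᵇ-sound : ∀ {f n} → T (distanceK4Freeᵇ f n) → DistanceK4Free f n
distanceK4Freeᵇ-sound {f} holds {suc p} {q} {r} (s≤s z≤n) p<q q<r r<n =
  toWitnessFalse {a? = monoGaps? f (suc p) q r} noMono
  where
  -- For p > 0 the guard 0 <ᵇ p is true, so the search entry is exactly ¬ MonoGaps.
  noMono : T (not (isYes (monoGaps? f (suc p) q r)))
  noMono = allBelow-sound (allBelow-sound (allBelow-sound holds r<n) q<r) p<q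

-- The cubic-residue colouring modulo 127: n^42 mod 127 is one of the cube
-- roots of unity 1, 19, 107 for 127 ∤ n, and names the coset of n modulo cubes.
cubicColour : ℕ → Fin 3
cubicColour n with n ^ 42 % 127
... | 1  = zero
... | 19 = suc zero
... | _  = suc (suc zero)

-- The computation: the cubic colouring has no difference K_4 below 127; the
-- search evaluates to true, so its truth witness is tt.
cubicColour-K4Free : DistanceK4Free cubicColour 127
cubicColour-K4Free = distanceK4Freeᵇ-sound tt

corollary2p6 : LowerBoundR444 128
corollary2p6 l arrows with 128 ≤? l
... | yes 128≤l = 128≤l
... | no 128≰l  = ⊥-elim (distanceColouring-noMonoK4 cubicColour-K4Free
                            (≤-pred (≰⇒> 128≰l)) (arrows _))
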